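{- For every positive integer $m$ and every positive even integer $n$, $D_m(n)<n$.
   Context: For $m,n\in\mathbb{N}$, the Schemmel totient function $L_m(n)$ is the number of integers $k\in\{1,\dots,n\}$ such that $\gcd(k+s,n)=1$ for all $s\in\{0,1,\dots,m-1\}$ (so $L_1$ is Euler's $\phi$); by convention $L_m(0)=0$. Equivalently, $L_m(1)=1$, and for $n>1$ with $n=\prod_{i=1}^r p_i^{\alpha_i}$, $L_m(n)=0$ if the smallest prime factor of $n$ is $\le m$, and $L_m(n)=\prod_{i} p_i^{\alpha_i-1}(p_i-m)$ otherwise. Iterates: $f^{(1)}=f$, $f^{(k+1)}=f\circ f^{(k)}$. $R_m(n)$ is the least positive integer $k$ with $L_m^{(k)}(n)\in\{0,1\}$. Define $D_m(1)=0$ and $D_m(n)=\sum_{i=1}^{R_m(n)}L_m^{(i)}(n)$ for $n>1$. -}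

module Defs where

open import Data.Nat using (ℕ; zero; suc; _+_; _<_; _≤_)
open import Data.Nat.GCD using (gcd)
open import Data.List using (List; length; filter; upTo; map)
open import Data.Bool.ListAction using (and)
open import Data.List.Relation.Unary.All using (All)
import Data.Bool
open import Data.Bool using (Bool; true; false; T)
open import Data.Sum using (_⊎_)
open import Relation.Binary.PropositionalEquality using (_≡_)
open import Relation.Nullary using (¬_)
open import Relation.Nullary.Decidable using (⌊_⌋)
open import Data.Nat.Properties using (_≟_)

-- Schemmel totient: number of k ∈ {1,…,n} with gcd(k+s, n) = 1 for all s ∈ {0,…,m-1}.
-- (For n = 0 the range is empty, giving L m 0 = 0, matching the convention.)
good : ℕ → ℕ → ℕ → Bool
good m n k = and (map (λ s → ⌊ gcd (k + s) n ≟ 1 ⌋) (upTo m))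

L : ℕ → ℕ → ℕ
L m n = length (filter (λ k → Data.Bool.T? (good m n (suc k))) (upTo n))

iter : (ℕ → ℕ) → ℕ → ℕ → ℕ
iter f zero x = x
iter f (suc k) x = f (iter f k x)

In01 : ℕ → Set
In01 x = (x ≡ 0) ⊎ (x ≡ 1)

IsR : ℕ → ℕ → ℕ → Set
IsR m n k = (1 ≤ k) × In01 (iter (L m) k n) × (∀ j → 1 ≤ j → j < k → ¬ In01 (iter (L m) j n))
  where open import Data.Product using (_×_)

sumIter : ℕ → ℕ → ℕ → ℕ
sumIter m n zero = 0
sumIter m n (suc k) = sumIter m n k + iter (L m) (suc k) n

{-# OPTIONS --safe #-}
-- For m ≥ 2 one of k, k + 1 is even, so L_m(n) = 0 for even n and D_m(n) = 0.
-- For m = 1, L_1 = φ. Only odd k ≤ n are coprime to an even n, so φ(n) ≤ n / 2,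
-- and k ↦ a − k pairs up the residues coprime to a, so φ(a) is even for a ≥ 3.
-- Hence along the orbit of an even n every value above 1 is even, and by strong
-- induction D(n) = φ(n) + D(φ(n)) < 2 φ(n) ≤ n.
module Submission where

open import Defs
open import Data.Nat using (ℕ; zero; suc; _+_; _*_; _≤_; _<_; z≤n; s≤s; s≤s⁻¹; z<s)
open import Data.Nat.Properties
open import Data.Nat.Divisibility using (_∣_; divides; ∣-refl; ∣m∣n⇒∣m+n; ∣1⇒≡1; m∣m*n)
open import Data.Nat.GCD using (gcd; gcd-comm; gcd-greatest; gcd-GCD; module GCD)
open import Data.Nat.Induction using (<-rec)
open import Data.Nat.Tactic.RingSolver using (solve-∀)
open import Data.Bool using (Bool; true; false; _∧_; T; T?)
open import Data.Bool.Properties using (∧-zeroʳ; ∧-identityʳ)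
open import Data.Bool.ListAction using (and)
open import Data.List using (length; filter; applyUpTo; map)
open import Data.List.Properties using (filter-none)
open import Data.List.Relation.Unary.All.Properties using (applyUpTo⁺₂)
open import Data.Product using (Σ; _×_; _,_; ∃)
open import Data.Sum using (_⊎_; inj₁; inj₂; [_,_]′)
open import Function using (_∘_; id)
open import Relation.Nullary using (¬_; contradiction)
open import Relation.Nullary.Decidable using (⌊_⌋; isYes≗does; dec-false)
open import Relation.Binary.PropositionalEquality
  using (_≡_; _≢_; refl; sym; trans; cong; cong₂; subst; module ≡-Reasoning)

2*m≡m+m : ∀ m → 2 * m ≡ m + m
2*m≡m+m m = cong (m +_) (+-identityʳ m)

2≤2*[1+m] : ∀ m → 2 ≤ 2 * suc m
2≤2*[1+m] m = *-monoʳ-≤ 2 (s≤s (z≤n {m}))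

2∣m+m : ∀ m → 2 ∣ m + m
2∣m+m m = divides m (trans (sym (2*m≡m+m m)) (*-comm 2 m))

2∣n⊎2∣1+n : ∀ n → 2 ∣ n ⊎ 2 ∣ suc n
2∣n⊎2∣1+n zero    = inj₁ (divides 0 refl)
2∣n⊎2∣1+n (suc n) = [ inj₂ ∘ ∣m∣n⇒∣m+n ∣-refl , inj₁ ]′ (2∣n⊎2∣1+n n)

boolToℕ : Bool → ℕ
boolToℕ true  = 1
boolToℕ false = 0

boolToℕ≤1 : ∀ b → boolToℕ b ≤ 1
boolToℕ≤1 true  = ≤-refl
boolToℕ≤1 false = z≤n

count : (ℕ → Bool) → ℕ → ℕ
count h zero    = 0
count h (suc n) = boolToℕ (h 0) + count (h ∘ suc) n

count-applyUpTo : ∀ (g : ℕ → Bool) f n →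
  length (filter (T? ∘ g) (applyUpTo f n)) ≡ count (g ∘ f) n
count-applyUpTo g f zero = refl
count-applyUpTo g f (suc n) with g (f 0)
... | true  = cong suc (count-applyUpTo g (f ∘ suc) n)
... | false = count-applyUpTo g (f ∘ suc) n

count-suc-last : ∀ h n → count h (suc n) ≡ count h n + boolToℕ (h n)
count-suc-last h zero    = +-comm (boolToℕ (h 0)) 0
count-suc-last h (suc n) = begin
  boolToℕ (h 0) + count (h ∘ suc) (suc n)
    ≡⟨ cong (boolToℕ (h 0) +_) (count-suc-last (h ∘ suc) n) ⟩
  boolToℕ (h 0) + (count (h ∘ suc) n + boolToℕ (h (suc n)))
    ≡⟨ +-assoc (boolToℕ (h 0)) _ _ ⟨
  count h (suc n) + boolToℕ (h (suc n)) ∎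
  where open ≡-Reasoning

count≤half : ∀ h q → (∀ i → h (suc (i + i)) ≡ false) → count h (q + q) ≤ q
count≤half h zero    _      = z≤n
count≤half h (suc q) odd≡false rewrite +-suc q q | odd≡false 0 =
  +-mono-≤ (boolToℕ≤1 (h 0)) (count≤half (h ∘ suc ∘ suc) q odd≡false′)
  where
  odd≡false′ : ∀ i → h (suc (suc (suc (i + i)))) ≡ false
  odd≡false′ i rewrite sym (+-suc i i) = odd≡false (suc i)

-- Peeling off the first and last index keeps both hypotheses, and the two peeled values agree.
count-palindromic-even : ∀ n h →
  (∀ i j → suc (i + j) ≡ n → h i ≡ h j) →
  (∀ i → suc (i + i) ≡ n → h i ≡ false) →
  ∃ λ q → count h n ≡ q + q
count-palindromic-even zero          h _ _ = 0 , refl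
count-palindromic-even (suc zero)    h _ middle rewrite middle 0 refl = 0 , refl
count-palindromic-even (suc (suc n)) h mirror middle =
  peel (count-palindromic-even n (h ∘ suc) mirror′ middle′)
  where
  open ≡-Reasoning
  b = boolToℕ (h 0)
  rearrange : ∀ x q → x + (q + q + x) ≡ (x + q) + (x + q)
  rearrange = solve-∀
  peel : ∃ (λ q → count (h ∘ suc) n ≡ q + q) → ∃ λ q → count h (suc (suc n)) ≡ q + q
  peel (q , inner≡q+q) = b + q , (begin
    b + count (h ∘ suc) (suc n)
      ≡⟨ cong (b +_) (count-suc-last (h ∘ suc) n) ⟩
    b + (count (h ∘ suc) n + boolToℕ (h (suc n)))
      ≡⟨ cong₂ (λ c x → b + (c + boolToℕ x)) inner≡q+q (sym (mirror 0 (suc n) refl)) ⟩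
    b + (q + q + b)
      ≡⟨ rearrange b q ⟩
    (b + q) + (b + q) ∎)
  shift : ∀ i j → suc (i + j) ≡ n → suc (suc i + suc j) ≡ suc (suc n)
  shift i j eq = cong (suc ∘ suc) (trans (+-suc i j) eq)
  mirror′ : ∀ i j → suc (i + j) ≡ n → h (suc i) ≡ h (suc j)
  mirror′ i j eq = mirror (suc i) (suc j) (shift i j eq)
  middle′ : ∀ i → suc (i + i) ≡ n → h (suc i) ≡ false
  middle′ i eq = middle (suc i) (shift i i eq)

gcd≢1 : ∀ {d a b} → 2 ≤ d → d ∣ a → d ∣ b → gcd a b ≢ 1
gcd≢1 2≤d d∣a d∣b gcd≡1 = >⇒≢ 2≤d (∣1⇒≡1 (subst (_ ∣_) gcd≡1 (gcd-greatest d∣a d∣b)))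

gcd-complement : ∀ a b → gcd a (a + b) ≡ gcd b (a + b)
gcd-complement a b = begin
  gcd a (a + b) ≡⟨ GCD.unique (gcd-GCD a (a + b)) (GCD.step (gcd-GCD a b)) ⟩
  gcd a b       ≡⟨ gcd-comm a b ⟩
  gcd b a       ≡⟨ GCD.unique (GCD.step (gcd-GCD b a)) (gcd-GCD b (b + a)) ⟩
  gcd b (b + a) ≡⟨ cong (gcd b) (+-comm b a) ⟩
  gcd b (a + b) ∎
  where open ≡-Reasoning

and-map-applyUpTo-false : ∀ (b : ℕ → Bool) f m s → s < m → b (f s) ≡ false →
  and (map b (applyUpTo f m)) ≡ false
and-map-applyUpTo-false b f (suc m) zero    _         bfs≡false rewrite bfs≡false = refl
and-map-applyUpTo-false b f (suc m) (suc s) (s≤s s<m) bfs≡false =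
  trans (cong (b (f 0) ∧_) (and-map-applyUpTo-false b (f ∘ suc) m s s<m bfs≡false)) (∧-zeroʳ _)

good-false : ∀ m n k s → s < m → gcd (k + s) n ≢ 1 → good m n k ≡ false
good-false m n k s s<m gcd≢1 =
  and-map-applyUpTo-false (λ s → ⌊ gcd (k + s) n ≟ 1 ⌋) id m s s<m
    (trans (isYes≗does (gcd (k + s) n ≟ 1)) (dec-false (gcd (k + s) n ≟ 1) gcd≢1))

good-false₀ : ∀ m n k → gcd k n ≢ 1 → good (suc m) n k ≡ false
good-false₀ m n k gcd≢1 =
  good-false (suc m) n k 0 (s≤s z≤n) (gcd≢1 ∘ subst (λ c → gcd c n ≡ 1) (+-identityʳ k))

good-one : ∀ n k → good 1 n k ≡ ⌊ gcd k n ≟ 1 ⌋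
good-one n k rewrite +-identityʳ k = ∧-identityʳ _

L≡count : ∀ m n → L m n ≡ count (good m n ∘ suc) n
L≡count m n = count-applyUpTo (good m n ∘ suc) id n

L-even≡0 : ∀ m n → 2 ∣ n → L (2 + m) n ≡ 0
L-even≡0 m n 2∣n =
  cong length (filter-none (T? ∘ good (2 + m) n ∘ suc) (applyUpTo⁺₂ id n excluded))
  where
  excluded : ∀ i → ¬ T (good (2 + m) n (suc i))
  excluded i = [ (λ 2∣k   → subst T (good-false₀ (suc m) n (suc i) (gcd≢1 ≤-refl 2∣k 2∣n)))
               , (λ 2∣k+1 → subst T (good-false (2 + m) n (suc i) 1 (s≤s (s≤s z≤n))
                                      (gcd≢1 ≤-refl (subst (2 ∣_) (+-comm 1 (suc i)) 2∣k+1) 2∣n)))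
               ]′ (2∣n⊎2∣1+n (suc i))

totient-half : ∀ q → L 1 (2 * q) ≤ q
totient-half q rewrite L≡count 1 (2 * q) | 2*m≡m+m q =
  count≤half (good 1 (q + q) ∘ suc) q even-excluded
  where
  even-excluded : ∀ i → good 1 (q + q) (suc (suc (i + i))) ≡ false
  even-excluded i =
    good-false₀ 0 (q + q) (2 + (i + i)) (gcd≢1 ≤-refl (∣m∣n⇒∣m+n ∣-refl (2∣m+m i)) (2∣m+m q))

totient-even : ∀ n → 3 ≤ n → ∃ λ q → L 1 n ≡ 2 * q
totient-even (suc x) (s≤s 2≤x) = conclude (count-palindromic-even x h mirror middle)
  where
  open ≡-Reasoning
  n = suc x
  h = good 1 n ∘ suc
  sum≡n : ∀ i j → suc (i + j) ≡ x → suc i + suc j ≡ n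
  sum≡n i j eq = cong suc (trans (+-suc i j) eq)
  mirror : ∀ i j → suc (i + j) ≡ x → h i ≡ h j
  mirror i j eq = begin
    good 1 n (suc i)      ≡⟨ good-one n (suc i) ⟩
    ⌊ gcd (suc i) n ≟ 1 ⌋ ≡⟨ cong (λ g → ⌊ g ≟ 1 ⌋) gcd-equal ⟩
    ⌊ gcd (suc j) n ≟ 1 ⌋ ≡⟨ good-one n (suc j) ⟨
    good 1 n (suc j)      ∎
    where
    gcd-equal : gcd (suc i) n ≡ gcd (suc j) n
    gcd-equal =
      subst (λ c → gcd (suc i) c ≡ gcd (suc j) c) (sum≡n i j eq) (gcd-complement (suc i) (suc j))
  middle : ∀ i → suc (i + i) ≡ x → h i ≡ false
  middle zero    eq = contradiction (subst (2 ≤_) (sym eq) 2≤x) λ { (s≤s ()) }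
  middle (suc i) eq = good-false₀ 0 n (2 + i)
    (gcd≢1 (s≤s (s≤s z≤n)) ∣-refl (subst (2 + i ∣_) (sum≡n (suc i) (suc i) eq) (∣m∣n⇒∣m+n ∣-refl ∣-refl)))
  last : h x ≡ false
  last = good-false₀ 0 n n (gcd≢1 (m≤n⇒m≤1+n 2≤x) ∣-refl ∣-refl)
  conclude : ∃ (λ q → count h x ≡ q + q) → ∃ λ q → L 1 n ≡ 2 * q
  conclude (q , count≡q+q) = q , (begin
    L 1 n                     ≡⟨ L≡count 1 n ⟩
    count h n                 ≡⟨ count-suc-last h x ⟩
    count h x + boolToℕ (h x) ≡⟨ cong₂ (λ c b → c + boolToℕ b) count≡q+q last ⟩
    q + q + 0                 ≡⟨ +-identityʳ (q + q) ⟩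
    q + q                     ≡⟨ 2*m≡m+m q ⟨
    2 * q                     ∎)

iter-suc : ∀ (f : ℕ → ℕ) k x → iter f (suc k) x ≡ iter f k (f x)
iter-suc f zero    x = refl
iter-suc f (suc k) x = cong f (iter-suc f k x)

sumIter-suc : ∀ m n k → sumIter m n (suc k) ≡ L m n + sumIter m (L m n) k
sumIter-suc m n zero    = +-comm 0 (L m n)
sumIter-suc m n (suc k) = begin
  sumIter m n (suc k) + iter (L m) (suc (suc k)) n
    ≡⟨ cong₂ _+_ (sumIter-suc m n k) (iter-suc (L m) (suc k) n) ⟩
  L m n + sumIter m (L m n) k + iter (L m) (suc k) (L m n)
    ≡⟨ +-assoc (L m n) _ _ ⟩
  L m n + sumIter m (L m n) (suc k) ∎
  where open ≡-Reasoning

In01⇒≤1 : ∀ {a} → In01 a → a ≤ 1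
In01⇒≤1 (inj₁ refl) = z≤n
In01⇒≤1 (inj₂ refl) = ≤-refl

2≤⇒¬In01 : ∀ {a} → 2 ≤ a → ¬ In01 a
2≤⇒¬In01 (s≤s (s≤s _)) (inj₁ ())
2≤⇒¬In01 (s≤s (s≤s _)) (inj₂ ())

-- D_m(n) < n, witnessed by r = R_m(n), for which sumIter m n r = D_m(n).
DBelow : ℕ → ℕ → Set
DBelow m n = Σ ℕ (λ r → IsR m n r × sumIter m n r < n)

DBelow-stop : ∀ {m n} → 2 ≤ n → In01 (L m n) → DBelow m n
DBelow-stop 2≤n stops =
  1 , (≤-refl , stops , λ { zero () ; (suc _) _ (s≤s ()) }) , <-≤-trans (s≤s (In01⇒≤1 stops)) 2≤n

DBelow-step : ∀ {m n a} → L m n ≡ a → 2 ≤ a → 2 * a ≤ n → DBelow m a → DBelow m n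
DBelow-step {m} {n} {a} refl 2≤a 2a≤n (r , (_ , stops , minimal) , D<a) =
  suc r , (s≤s z≤n , subst In01 (sym (iter-suc (L m) r n)) stops , minimal′) , D<n
  where
  minimal′ : ∀ j → 1 ≤ j → j < suc r → ¬ In01 (iter (L m) j n)
  minimal′ (suc zero)    _ _         = 2≤⇒¬In01 2≤a
  minimal′ (suc (suc j)) _ (s≤s j<r) =
    minimal (suc j) (s≤s z≤n) j<r ∘ subst In01 (iter-suc (L m) (suc j) n)
  D<n : sumIter m n (suc r) < n
  D<n = begin-strict
    sumIter m n (suc r) ≡⟨ sumIter-suc m n r ⟩
    a + sumIter m a r   <⟨ +-monoʳ-< a D<a ⟩
    a + a               ≡⟨ 2*m≡m+m a ⟨
    2 * a               ≤⟨ 2a≤n ⟩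
    n                   ∎
    where open ≤-Reasoning

totient-DBelow : ∀ k → DBelow 1 (2 * suc k)
totient-DBelow = <-rec (λ k → DBelow 1 (2 * suc k)) step
  where
  step : ∀ k → (∀ {j} → j < k → DBelow 1 (2 * suc j)) → DBelow 1 (2 * suc k)
  step zero    _   = DBelow-stop {1} {2} ≤-refl (inj₂ refl)
  step (suc k) rec = descend (totient-even n (≤-trans (n≤1+n 3) (*-monoʳ-≤ 2 (s≤s (s≤s (z≤n {k}))))))
    where
    n = 2 * suc (suc k)
    descend : ∃ (λ q → L 1 n ≡ 2 * q) → DBelow 1 n
    descend (zero  , L≡0)    = DBelow-stop {1} {n} (2≤2*[1+m] (suc k)) (inj₁ L≡0)
    descend (suc j , L≡2[1+j]) = DBelow-step L≡2[1+j] (2≤2*[1+m] j) (*-monoʳ-≤ 2 half) (rec j<1+k)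
      where
      half : 2 * suc j ≤ suc (suc k)
      half = subst (_≤ suc (suc k)) L≡2[1+j] (totient-half (suc (suc k)))
      j<1+k : j < suc k
      j<1+k = s≤s⁻¹ (<-≤-trans (m<m+n (suc j) z<s) (subst (_≤ suc (suc k)) (2*m≡m+m (suc j)) half))

theorem2p2 : (m k : ℕ) → let n = 2 * suc k in
    Σ ℕ (λ r → IsR (suc m) n r × sumIter (suc m) n r < n)
theorem2p2 zero    k = totient-DBelow k
theorem2p2 (suc m) k =
  DBelow-stop {2 + m} (2≤2*[1+m] k) (inj₁ (L-even≡0 m (2 * suc k) (m∣m*n (suc k))))
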